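{- For every $n\ge1$ and every $\sigma\in S_n$, Han's map satisfies $H(c\sigma)=cH(\sigma)$, where $c$ is complementation.
   Context: $S_n$ is the set of permutations of $[n]$ in one-line notation. For $\sigma\in S_n$, the complement $c\sigma=\tau_1\cdots\tau_n$ with $\tau_i=n+1-\sigma_i$. For $x\in[n]$ and a permutation $\sigma=\sigma_1\cdots\sigma_{n-1}$ of $[n]\setminus\{x\}$, define $C^x(\sigma)=\tau_1\cdots\tau_{n-1}\in S_{n-1}$ with $\tau_i=\sigma_i-x+n$ if $\sigma_i<x$ and $\tau_i=\sigma_i-x$ if $\sigma_i>x$; and $C_x(\sigma)=\nu_1\cdots\nu_{n-1}\in S_{n-1}$ with $\nu_i=\sigma_i$ if $\sigma_i<x$ and $\nu_i=\sigma_i-1$ if $\sigma_i>x$ (both are bijections onto $S_{n-1}$). Han's map $H\colon S_n\to S_n$ is defined recursively by $H(1)=1$ and, for $n>1$ and $\sigma'=\sigma_1\cdots\sigma_{n-1}$, $H(\sigma)=C_{\sigma_n}^{ -1}\big(H(C^{\sigma_n}(\sigma'))\big)\cdot\sigma_n$ (concatenation). -}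

module Defs where

open import Data.Nat using (ℕ; zero; suc; _+_; _∸_; _<ᵇ_)
open import Data.Bool using (if_then_else_)
open import Data.List using (List; []; _∷_; map; reverse; upTo)
open import Data.List.Relation.Binary.Permutation.Propositional using (_↭_)

-- Permutations of [n] = {1,…,n} in one-line notation are lists of naturals
-- that are a rearrangement of 1,2,…,n.
oneTo : ℕ → List ℕ
oneTo n = map suc (upTo n)

IsPerm : ℕ → List ℕ → Set
IsPerm n σ = σ ↭ oneTo n

compl : ℕ → List ℕ → List ℕ
compl n σ = map (λ s → suc n ∸ s) σ

-- C^x on a word of [n]∖{x}: s ↦ s - x + n if s < x, s - x if s > x
Cup : ℕ → ℕ → List ℕ → List ℕ
Cup n x σ = map (λ s → if s <ᵇ x then s + n ∸ x else s ∸ x) σ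

-- C_x^{-1} : S_{n-1} → permutations of [n]∖{x}: v ↦ v if v < x, v + 1 if v ≥ x
CdownInv : ℕ → List ℕ → List ℕ
CdownInv x ν = map (λ v → if v <ᵇ x then v else suc v) ν

-- Han's map on reversed words: the input is σ reversed (σ_n first),
-- the output is H(σ) reversed.  The first argument is n (the length).
Hrev : ℕ → List ℕ → List ℕ
Hrev zero    _        = []
Hrev (suc m) []       = []
Hrev (suc m) (x ∷ rs) = x ∷ CdownInv x (Hrev m (Cup (suc m) x rs))

-- Han's map H : S_n → S_n:
-- H(σ) = C_{σ_n}^{-1}(H(C^{σ_n}(σ_1⋯σ_{n-1}))) · σ_n,  H(1) = 1.
H : ℕ → List ℕ → List ℕ
H n σ = reverse (Hrev n (reverse σ))

-- Han's map is built letter by letter from the maps C^x and C_x^{-1}, and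
-- each of them intertwines complements: for distinct letters s ≠ x of [n],
-- C^{n+1-x}(n+1-s) = n-(C^x s), and for v in [n-1],
-- C_{n+1-x}^{-1}(n-v) = n+1-(C_x^{-1} v).  Induction on n along the
-- recursion then gives H(cσ) = cH(σ).  The induction runs over arbitrary
-- words of distinct letters of [n], an invariant that C^x preserves
-- because it is injective away from x.
module Submission where

open import Defs
open import Data.Bool using (true; false; if_then_else_; T)
open import Data.Empty using (⊥-elim)
open import Data.List using (List; []; _∷_; map; reverse)
open import Data.List.Properties using (map-∘; map-cong-local; reverse-map)
open import Data.List.Relation.Binary.Permutation.Propositional
  using (_↭_; ↭-sym; ↭-trans; ↭⇒↭ₛ)
open import Data.List.Relation.Binary.Permutation.Propositional.Properties
  using (All-resp-↭; ↭-reverse)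
open import Data.List.Relation.Unary.All as All using (All; []; _∷_)
import Data.List.Relation.Unary.All.Properties as All
open import Data.List.Relation.Unary.AllPairs using ([]; _∷_)
open import Data.List.Relation.Unary.Unique.Propositional using (Unique)
import Data.List.Relation.Unary.Unique.Propositional.Properties as Unique
open import Data.Nat using (ℕ; zero; suc; _+_; _∸_; _<ᵇ_; _≤_; _<_; _≥_; s≤s; z≤n)
open import Data.Nat.Properties
open import Data.Nat.Tactic.RingSolver using (solve-∀)
open import Data.Product using (_×_; _,_; proj₂)
open import Data.Unit using (tt)
open import Function using (_∘_)
open import Relation.Binary using (tri<; tri≈; tri>)
open import Relation.Binary.PropositionalEquality
  using (_≡_; _≢_; refl; sym; trans; cong; cong₂; subst; setoid; module ≡-Reasoning)
open import Data.List.Relation.Binary.Permutation.Setoid.Properties (setoid ℕ)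
  using (Unique-resp-↭)
open import Relation.Nullary using (yes; no)

open ≡-Reasoning

private
  variable
    a b k n s x v : ℕ

compl₁ : ℕ → ℕ → ℕ
compl₁ n s = suc n ∸ s

Cup₁ : ℕ → ℕ → ℕ → ℕ
Cup₁ n x s = if s <ᵇ x then s + n ∸ x else s ∸ x

CdownInv₁ : ℕ → ℕ → ℕ
CdownInv₁ x v = if v <ᵇ x then v else suc v

InRange : ℕ → ℕ → Set
InRange n s = 1 ≤ s × s ≤ n

<⇒<ᵇ≡true : a < b → (a <ᵇ b) ≡ true
<⇒<ᵇ≡true {a} {b} a<b with a <ᵇ b | <⇒<ᵇ a<b
... | true | _ = refl

≥⇒<ᵇ≡false : b ≤ a → (a <ᵇ b) ≡ false
≥⇒<ᵇ≡false {b} {a} b≤a with a <ᵇ b in eq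
... | false = refl
... | true  = ⊥-elim (<⇒≱ (<ᵇ⇒< a b (subst T (sym eq) tt)) b≤a)

m+n≡o⇒o∸m≡n : ∀ b → b + k ≡ a → a ∸ b ≡ k
m+n≡o⇒o∸m≡n {k} b refl = m+n∸m≡n b k

compl₁-≡ : ∀ a → a + k ≡ n → compl₁ n a ≡ suc k
compl₁-≡ {k} a eq = m+n≡o⇒o∸m≡n a (trans (+-suc a k) (cong suc eq))

data Chain : ℕ → ℕ → ℕ → Set where
  chain : ∀ a d e → Chain a (a + d) (a + d + e)

chain-view : a ≤ b → b ≤ k → Chain a b k
chain-view a≤b b≤k with m≤n⇒∃[o]m+o≡n a≤b
... | d , refl with m≤n⇒∃[o]m+o≡n b≤k
...   | e , refl = chain _ d e

-- Apart m x s: s < x ≤ 1 + m or x < s ≤ 1 + m.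
data Apart : ℕ → ℕ → ℕ → Set where
  below : ∀ s d e → Apart (s + d + e) (suc (s + d)) s
  above : ∀ x d e → Apart (x + d + e) x (suc (x + d))

apart : ∀ {m} → x ≤ suc m → s ≤ suc m → x ≢ s → Apart m x s
apart {x = x} {s = s} x≤ s≤ x≢s with <-cmp s x
... | tri≈ _ s≡x _ = ⊥-elim (x≢s (sym s≡x))
... | tri< s<x _ _ with chain-view s<x x≤
...   | chain _ d e = below s d e
apart {x = x} x≤ s≤ x≢s | tri> _ _ x<s with chain-view x<s s≤
...   | chain _ d e = above x d e

Cup₁-< : s < x → Cup₁ n x s ≡ s + n ∸ x
Cup₁-< s<x rewrite <⇒<ᵇ≡true s<x = refl

Cup₁-≥ : x ≤ s → Cup₁ n x s ≡ s ∸ x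
Cup₁-≥ x≤s rewrite ≥⇒<ᵇ≡false x≤s = refl

CdownInv₁-< : v < x → CdownInv₁ x v ≡ v
CdownInv₁-< v<x rewrite <⇒<ᵇ≡true v<x = refl

CdownInv₁-≥ : x ≤ v → CdownInv₁ x v ≡ suc v
CdownInv₁-≥ x≤v rewrite ≥⇒<ᵇ≡false x≤v = refl

Cup₁-below : ∀ s d e → Cup₁ (suc (s + d + e)) (suc (s + d)) s ≡ s + e
Cup₁-below s d e =
  trans (Cup₁-< (s≤s (m≤m+n s d))) (m+n≡o⇒o∸m≡n (suc (s + d)) (shape s d e))
  where
    shape : ∀ s d e → suc (s + d) + (s + e) ≡ s + suc (s + d + e)
    shape = solve-∀

Cup₁-above : ∀ x d e → Cup₁ (suc (x + d + e)) x (suc (x + d)) ≡ suc d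
Cup₁-above x d e =
  trans (Cup₁-≥ (m≤n⇒m≤1+n (m≤m+n x d))) (m+n≡o⇒o∸m≡n x (+-suc x d))

compl₁-suc-+ : ∀ a d e → compl₁ (suc (a + d + e)) a ≡ suc (suc (d + e))
compl₁-suc-+ a d e =
  compl₁-≡ a (trans (+-suc a (d + e)) (cong suc (sym (+-assoc a d e))))

Cup₁-compl₁ : ∀ {m} → x ≤ suc m → s ≤ suc m → x ≢ s →
              Cup₁ (suc m) (compl₁ (suc m) x) (compl₁ (suc m) s)
                ≡ compl₁ m (Cup₁ (suc m) x s)
Cup₁-compl₁ x≤ s≤ x≢s with apart x≤ s≤ x≢s
... | below s d e = begin
  Cup₁ (suc m) (compl₁ (suc m) (suc (s + d))) (compl₁ (suc m) s)
    ≡⟨ cong₂ (Cup₁ (suc m)) (compl₁-≡ (suc (s + d)) refl) (compl₁-suc-+ s d e) ⟩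
  Cup₁ (suc m) (suc e) (suc (suc (d + e)))
    ≡⟨ Cup₁-≥ (s≤s (m≤n+m e (suc d))) ⟩
  suc d + e ∸ e
    ≡⟨ m+n∸n≡m (suc d) e ⟩
  suc d
    ≡⟨ compl₁-≡ (s + e) (shape s d e) ⟨
  compl₁ m (s + e)
    ≡⟨ cong (compl₁ m) (Cup₁-below s d e) ⟨
  compl₁ m (Cup₁ (suc m) (suc (s + d)) s) ∎
  where
    m = s + d + e
    shape : ∀ s d e → s + e + d ≡ s + d + e
    shape = solve-∀
... | above x d e = begin
  Cup₁ (suc m) (compl₁ (suc m) x) (compl₁ (suc m) (suc (x + d)))
    ≡⟨ cong₂ (Cup₁ (suc m)) (compl₁-suc-+ x d e) (compl₁-≡ (suc (x + d)) refl) ⟩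
  Cup₁ (suc m) (suc (suc (d + e))) (suc e)
    ≡⟨ Cup₁-< (s≤s (s≤s (m≤n+m e d))) ⟩
  suc e + suc m ∸ suc (suc (d + e))
    ≡⟨ m+n≡o⇒o∸m≡n (suc (suc (d + e))) (shape x d e) ⟩
  x + e
    ≡⟨ m+n≡o⇒o∸m≡n d (shape′ x d e) ⟨
  compl₁ m (suc d)
    ≡⟨ cong (compl₁ m) (Cup₁-above x d e) ⟨
  compl₁ m (Cup₁ (suc m) x (suc (x + d))) ∎
  where
    m = x + d + e
    shape : ∀ x d e → suc (suc (d + e)) + (x + e) ≡ suc e + suc (x + d + e)
    shape = solve-∀
    shape′ : ∀ x d e → d + (x + e) ≡ x + d + e
    shape′ = solve-∀

CdownInv₁-compl₁ : ∀ {m} → x ≤ suc m → v ≤ m →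
                   CdownInv₁ (compl₁ (suc m) x) (compl₁ m v)
                     ≡ compl₁ (suc m) (CdownInv₁ x v)
CdownInv₁-compl₁ {x} {v} x≤ v≤ with v <? x
... | yes v<x with chain-view v<x x≤
...   | chain _ d e = begin
  CdownInv₁ (compl₁ (suc m) (suc (v + d))) (compl₁ m v)
    ≡⟨ cong₂ CdownInv₁ (compl₁-≡ (suc (v + d)) refl)
                       (compl₁-≡ v (sym (+-assoc v d e))) ⟩
  CdownInv₁ (suc e) (suc (d + e))
    ≡⟨ CdownInv₁-≥ (s≤s (m≤n+m e d)) ⟩
  suc (suc (d + e))
    ≡⟨ compl₁-suc-+ v d e ⟨
  compl₁ (suc m) v
    ≡⟨ cong (compl₁ (suc m)) (CdownInv₁-< v<x) ⟨
  compl₁ (suc m) (CdownInv₁ (suc (v + d)) v) ∎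
  where
    m = v + d + e
CdownInv₁-compl₁ {x} x≤ v≤ | no v≮x with chain-view (≮⇒≥ v≮x) v≤
...   | chain _ d e = begin
  CdownInv₁ (compl₁ (suc m) x) (compl₁ m (x + d))
    ≡⟨ cong₂ CdownInv₁ (compl₁-suc-+ x d e) (compl₁-≡ (x + d) refl) ⟩
  CdownInv₁ (suc (suc (d + e))) (suc e)
    ≡⟨ CdownInv₁-< (s≤s (s≤s (m≤n+m e d))) ⟩
  suc e
    ≡⟨ compl₁-≡ (x + d) refl ⟨
  compl₁ (suc m) (suc (x + d))
    ≡⟨ cong (compl₁ (suc m)) (CdownInv₁-≥ (m≤m+n x d)) ⟨
  compl₁ (suc m) (CdownInv₁ x (x + d)) ∎
  where
    m = x + d + e

-- C^x s is s - x (mod n), undone by u ↦ u + x (mod n)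
Cup₁⁻¹ : ℕ → ℕ → ℕ → ℕ
Cup₁⁻¹ n x u = if n <ᵇ u + x then u + x ∸ n else u + x

Cup₁⁻¹-> : ∀ x u → n < u + x → Cup₁⁻¹ n x u ≡ u + x ∸ n
Cup₁⁻¹-> x u n<u+x rewrite <⇒<ᵇ≡true n<u+x = refl

Cup₁⁻¹-≤ : ∀ x u → u + x ≤ n → Cup₁⁻¹ n x u ≡ u + x
Cup₁⁻¹-≤ x u u+x≤n rewrite ≥⇒<ᵇ≡false u+x≤n = refl

Cup₁⁻¹-Cup₁ : ∀ {m} → x ≤ suc m → InRange (suc m) s → x ≢ s →
              Cup₁⁻¹ (suc m) x (Cup₁ (suc m) x s) ≡ s
Cup₁⁻¹-Cup₁ x≤ (1≤s , s≤) x≢s with apart x≤ s≤ x≢s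
... | below s d e = begin
  Cup₁⁻¹ (suc m) (suc (s + d)) (Cup₁ (suc m) (suc (s + d)) s)
    ≡⟨ cong (Cup₁⁻¹ (suc m) (suc (s + d))) (Cup₁-below s d e) ⟩
  Cup₁⁻¹ (suc m) (suc (s + d)) (s + e)
    ≡⟨ Cup₁⁻¹-> (suc (s + d)) (s + e)
         (subst (suc m <_) (shape s d e) (m<m+n (suc m) 1≤s)) ⟩
  s + e + suc (s + d) ∸ suc m
    ≡⟨ m+n≡o⇒o∸m≡n (suc m) (shape s d e) ⟩
  s ∎
  where
    m = s + d + e
    shape : ∀ s d e → suc (s + d + e) + s ≡ s + e + suc (s + d)
    shape = solve-∀
... | above x d e = begin
  Cup₁⁻¹ (suc m) x (Cup₁ (suc m) x (suc (x + d)))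
    ≡⟨ cong (Cup₁⁻¹ (suc m) x) (Cup₁-above x d e) ⟩
  Cup₁⁻¹ (suc m) x (suc d)
    ≡⟨ Cup₁⁻¹-≤ x (suc d)
         (s≤s (subst (_≤ m) (+-comm x d) (m≤m+n (x + d) e))) ⟩
  suc (d + x)
    ≡⟨ cong suc (+-comm d x) ⟩
  suc (x + d) ∎
  where
    m = x + d + e

Cup₁-injective : ∀ {m t} → x ≤ suc m →
                 InRange (suc m) s × x ≢ s → InRange (suc m) t × x ≢ t →
                 Cup₁ (suc m) x s ≡ Cup₁ (suc m) x t → s ≡ t
Cup₁-injective {x} {s} {m} {t} x≤ (s∈ , x≢s) (t∈ , x≢t) eq = begin
  s                                    ≡⟨ Cup₁⁻¹-Cup₁ x≤ s∈ x≢s ⟨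
  Cup₁⁻¹ (suc m) x (Cup₁ (suc m) x s)  ≡⟨ cong (Cup₁⁻¹ (suc m) x) eq ⟩
  Cup₁⁻¹ (suc m) x (Cup₁ (suc m) x t)  ≡⟨ Cup₁⁻¹-Cup₁ x≤ t∈ x≢t ⟩
  t                                    ∎

Cup₁-inRange : ∀ {m} → InRange (suc m) x → InRange (suc m) s → x ≢ s →
               InRange m (Cup₁ (suc m) x s)
Cup₁-inRange (1≤x , x≤) (1≤s , s≤) x≢s with apart x≤ s≤ x≢s
... | below s d e rewrite Cup₁-below s d e =
  ≤-trans 1≤s (m≤m+n s e) , +-monoˡ-≤ e (m≤m+n s d)
... | above x d e rewrite Cup₁-above x d e =
  s≤s z≤n , ≤-trans (+-monoˡ-≤ d 1≤x) (m≤m+n (x + d) e)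

CdownInv₁-≤ : ∀ {m} → v ≤ m → CdownInv₁ x v ≤ suc m
CdownInv₁-≤ {v} {x} v≤ with v <ᵇ x
... | true  = m≤n⇒m≤1+n v≤
... | false = s≤s v≤

map-commute-local : ∀ {A B C D : Set} {f : B → D} {g : A → B}
                    {h : C → D} {k : A → C} {xs : List A} →
                    All (λ a → f (g a) ≡ h (k a)) xs →
                    map f (map g xs) ≡ map h (map k xs)
map-commute-local {xs = xs} fg≡hk =
  trans (sym (map-∘ xs)) (trans (map-cong-local fg≡hk) (map-∘ xs))

Unique-map⁺-local : ∀ {A B : Set} {P : A → Set} {f : A → B} {xs : List A} →
                    (∀ {a b} → P a → P b → f a ≡ f b → a ≡ b) →
                    All P xs → Unique xs → Unique (map f xs)
Unique-map⁺-local inj []         []          = []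
Unique-map⁺-local inj (pa ∷ pxs) (a∉ ∷ xs!) =
  All.map⁺ (All.zipWith (λ (pb , a≢b) → a≢b ∘ inj pa pb) (pxs , a∉))
    ∷ Unique-map⁺-local inj pxs xs!

PartialPerm : ℕ → List ℕ → Set
PartialPerm n w = All (InRange n) w × Unique w

private
  variable
    w : List ℕ

letters-apart : PartialPerm n (x ∷ w) → All (λ s → InRange n s × x ≢ s) w
letters-apart (_ ∷ w∈ , x∉ ∷ _) = All.zip (w∈ , x∉)

Cup-partialPerm : ∀ {m} → PartialPerm (suc m) (x ∷ w) →
                  PartialPerm m (Cup (suc m) x w)
Cup-partialPerm p@(x∈ ∷ _ , _ ∷ w!) =
  All.map⁺ (All.map (λ (s∈ , x≢s) → Cup₁-inRange x∈ s∈ x≢s)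
                    (letters-apart p)) ,
  Unique-map⁺-local (Cup₁-injective (proj₂ x∈)) (letters-apart p) w!

Cup-compl : ∀ {m} → PartialPerm (suc m) (x ∷ w) →
            Cup (suc m) (compl₁ (suc m) x) (compl (suc m) w) ≡ compl m (Cup (suc m) x w)
Cup-compl p@(x∈ ∷ _ , _) = map-commute-local
  (All.map (λ (s∈ , x≢s) → Cup₁-compl₁ (proj₂ x∈) (proj₂ s∈) x≢s)
           (letters-apart p))

CdownInv-compl : ∀ {m} → x ≤ suc m → All (_≤ m) w →
                 CdownInv (compl₁ (suc m) x) (compl m w) ≡ compl (suc m) (CdownInv x w)
CdownInv-compl x≤ w≤ = map-commute-local (All.map (CdownInv₁-compl₁ x≤) w≤)

Hrev-≤ : PartialPerm n w → All (_≤ n) (Hrev n w)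
Hrev-≤ {zero}  _ = []
Hrev-≤ {suc m} {[]} _ = []
Hrev-≤ {suc m} {x ∷ w} p@(x∈ ∷ _ , _) =
  proj₂ x∈ ∷
  All.map⁺ (All.map (CdownInv₁-≤ {x = x}) (Hrev-≤ (Cup-partialPerm p)))

Hrev-compl : PartialPerm n w → Hrev n (compl n w) ≡ compl n (Hrev n w)
Hrev-compl {zero}  _ = refl
Hrev-compl {suc m} {[]} _ = refl
Hrev-compl {suc m} {x ∷ w} p@(x∈ ∷ _ , _) = cong (compl₁ (suc m) x ∷_) (begin
  CdownInv x′ (Hrev m (Cup (suc m) x′ (compl (suc m) w)))
    ≡⟨ cong (CdownInv x′ ∘ Hrev m) (Cup-compl p) ⟩
  CdownInv x′ (Hrev m (compl m ρ))
    ≡⟨ cong (CdownInv x′) (Hrev-compl (Cup-partialPerm p)) ⟩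
  CdownInv x′ (compl m (Hrev m ρ))
    ≡⟨ CdownInv-compl (proj₂ x∈) (Hrev-≤ (Cup-partialPerm p)) ⟩
  compl (suc m) (CdownInv x (Hrev m ρ)) ∎)
  where
    x′ = compl₁ (suc m) x
    ρ  = Cup (suc m) x w

PartialPerm-resp-↭ : ∀ {w′} → w ↭ w′ → PartialPerm n w → PartialPerm n w′
PartialPerm-resp-↭ w↭w′ (w∈ , w!) =
  All-resp-↭ w↭w′ w∈ , Unique-resp-↭ (↭⇒↭ₛ w↭w′) w!

oneTo-partialPerm : ∀ n → PartialPerm n (oneTo n)
oneTo-partialPerm n =
  All.map⁺ (All.map (λ i<n → s≤s z≤n , i<n) (All.all-upTo n)) ,
  Unique.map⁺ suc-injective (Unique.upTo⁺ n)

corollary2p4 : (n : ℕ) → n ≥ 1 → (σ : List ℕ) → IsPerm n σ →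
                   H n (compl n σ) ≡ compl n (H n σ)
corollary2p4 n _ σ σ↭ = begin
  reverse (Hrev n (reverse (compl n σ)))
    ≡⟨ cong (reverse ∘ Hrev n) (reverse-map (compl₁ n) σ) ⟨
  reverse (Hrev n (compl n (reverse σ)))
    ≡⟨ cong reverse (Hrev-compl reverse-σ-partialPerm) ⟩
  reverse (compl n (Hrev n (reverse σ)))
    ≡⟨ reverse-map (compl₁ n) (Hrev n (reverse σ)) ⟨
  compl n (H n σ) ∎
  where
    reverse-σ-partialPerm : PartialPerm n (reverse σ)
    reverse-σ-partialPerm =
      PartialPerm-resp-↭ (↭-sym (↭-trans (↭-reverse σ) σ↭)) (oneTo-partialPerm n)
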